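{- For every integer $n\ge 1$, the languages $L_{H(n)}=\{w\in\Sigma^*:\phi(w)\in H(n)\}$ and $L_{F(n)}=\{w\in\Sigma^*:\phi(w)\in F(n)\}$ are regular.
   Context: $\mathrm{GL}(2,\mathbb{Z})$ is the group of $2\times 2$ integer matrices with determinant $\pm1$. Let $\Sigma=\{X,N,S,R\}$ and let $\phi:\Sigma^*\to\mathrm{GL}(2,\mathbb{Z})$ be the monoid morphism determined by $\phi(X)=\begin{bmatrix}-1&0\\0&-1\end{bmatrix}$, $\phi(N)=\begin{bmatrix}1&0\\0&-1\end{bmatrix}$, $\phi(S)=\begin{bmatrix}0&-1\\1&0\end{bmatrix}$, $\phi(R)=\begin{bmatrix}0&-1\\1&1\end{bmatrix}$. $H(n)=\{(a_{ij})\in\mathrm{GL}(2,\mathbb{Z}) : n\mid a_{21}\}$ and $F(n)=\{(a_{ij})\in\mathrm{GL}(2,\mathbb{Z}) : n\mid a_{12}\}$. -}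

module Defs where

open import Data.Nat using (ℕ; _≥_)
open import Data.Integer as ℤ using (ℤ; +_; -_; _+_; _*_; _-_)
open import Data.Integer.Divisibility using (_∣_)
open import Data.Fin using (Fin)
open import Data.List using (List; []; _∷_)
open import Data.Bool using (Bool; true)
open import Data.Sum using (_⊎_)
open import Data.Product using (Σ; _×_)
open import Function.Bundles using (_⇔_)
open import Relation.Binary.PropositionalEquality using (_≡_)
open import Level using (0ℓ)

data Letter : Set where
  X N S R : Letter

record Mat2 : Set where
  constructor mat
  field
    a11 a12 a21 a22 : ℤ
open Mat2 public

_·_ : Mat2 → Mat2 → Mat2
mat a b c d · mat e f g h = mat (a * e + b * g) (a * f + b * h) (c * e + d * g) (c * f + d * h)

I₂ : Mat2
I₂ = mat (+ 1) (+ 0) (+ 0) (+ 1)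

det : Mat2 → ℤ
det (mat a b c d) = a * d - b * c

InGL : Mat2 → Set
InGL M = (det M ≡ + 1) ⊎ (det M ≡ - (+ 1))

φ₁ : Letter → Mat2
φ₁ X = mat (- (+ 1)) (+ 0) (+ 0) (- (+ 1))
φ₁ N = mat (+ 1) (+ 0) (+ 0) (- (+ 1))
φ₁ S = mat (+ 0) (- (+ 1)) (+ 1) (+ 0)
φ₁ R = mat (+ 0) (- (+ 1)) (+ 1) (+ 1)

φ : List Letter → Mat2
φ []       = I₂
φ (c ∷ w)  = φ₁ c · φ w

H : ℕ → Mat2 → Set
H n M = InGL M × ((+ n) ∣ a21 M)

F : ℕ → Mat2 → Set
F n M = InGL M × ((+ n) ∣ a12 M)

Language : Set₁
Language = List Letter → Set

Lang : (Mat2 → Set) → Language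
Lang G w = G (φ w)

record DFA : Set where
  field
    k      : ℕ
    δ      : Fin k → Letter → Fin k
    start  : Fin k
    accept : Fin k → Bool

  run : Fin k → List Letter → Fin k
  run q []      = q
  run q (c ∷ w) = run (δ q c) w

  Accepts : List Letter → Set
  Accepts w = accept (run start w) ≡ true

Regular : Language → Set
Regular L = Σ DFA λ A → ∀ w → L w ⇔ DFA.Accepts A w

-- Track a row vector modulo n, multiplying it on the right by φ(c) letter by
-- letter: the row (0,1) ends as the bottom row (a₂₁, a₂₂) of φ(w) and (1,0) as
-- its top row (a₁₁, a₁₂). Since this action of integer matrices is compatible
-- with reduction mod n, n² states decide n ∣ a₂₁ resp. n ∣ a₁₂; the
-- determinant condition is free because every φ(w) lies in GL(2,ℤ).
module Submission where

open import Defs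
open import Data.Nat as ℕ using (ℕ; _≥_; NonZero; >-nonZero)
import Data.Nat.Properties as ℕ
import Data.Nat.Divisibility as ℕ
open import Data.Integer using (ℤ; +_; -_; _+_; _*_; _-_; ∣_∣; 0ℤ)
open import Data.Integer.Properties using (+-identityʳ; ∣i∣≡0⇒i≡0; i-j≡0⇒i≡j; +-injective; [+m]-[+n]≡m⊖n; ∣m⊝n∣≤m⊔n)
open import Data.Integer.Tactic.RingSolver using (solve-∀)
open import Data.Integer.Divisibility using (_∣_)
open import Data.Integer.Divisibility.Signed as Signed using (divides; ∣ᵤ⇒∣; ∣⇒∣ᵤ)
open import Data.Integer.DivMod using (_%ℕ_; _/ℕ_; n%ℕd<d; a≡a%ℕn+[a/ℕn]*n)
open import Data.Fin as Fin using (Fin; toℕ; fromℕ<)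
open import Data.Fin.Properties using (toℕ-fromℕ<; toℕ<n; toℕ-injective; *↔×)
open import Data.Product using (_×_; _,_; proj₁; proj₂)
open import Data.Sum using (_⊎_; inj₁; inj₂)
open import Data.Bool using (true)
open import Data.List using ([]; _∷_; foldl)
open import Function using (_∘_; _⇔_; mk⇔; Equivalence; _↔_; Inverse)
import Function.Properties.Equivalence as ⇔
open import Relation.Binary.PropositionalEquality
open import Relation.Nullary using (Dec; yes; no; does; contradiction)
open import Relation.Unary using (Decidable)

Row : Set
Row = ℤ × ℤ

infixl 7 _⋆_

_⋆_ : Row → Mat2 → Row
(x , y) ⋆ mat a b c d = (x * a + y * c , x * b + y * d)

⋆-· : ∀ r A B → r ⋆ (A · B) ≡ (r ⋆ A) ⋆ B
⋆-· (x , y) (mat a b c d) (mat e f g h) = cong₂ _,_ (regroup x y a b c d e g) (regroup x y a b c d f h)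
  where
  regroup : ∀ x y a b c d e g →
            x * (a * e + b * g) + y * (c * e + d * g) ≡ (x * a + y * c) * e + (x * b + y * d) * g
  regroup = solve-∀

⋆-I₂ : ∀ r → r ⋆ I₂ ≡ r
⋆-I₂ (x , y) = cong₂ _,_ (first x y) (second x y)
  where
  first : ∀ x y → x * + 1 + y * + 0 ≡ x
  first = solve-∀
  second : ∀ x y → x * + 0 + y * + 1 ≡ y
  second = solve-∀

e₂⋆≡bottom-row : ∀ M → (+ 0 , + 1) ⋆ M ≡ (a21 M , a22 M)
e₂⋆≡bottom-row (mat a b c d) = cong₂ _,_ (select a c) (select b d)
  where
  select : ∀ a c → + 0 * a + + 1 * c ≡ c
  select = solve-∀

e₁⋆≡top-row : ∀ M → (+ 1 , + 0) ⋆ M ≡ (a11 M , a12 M)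
e₁⋆≡top-row (mat a b c d) = cong₂ _,_ (select a c) (select b d)
  where
  select : ∀ a c → + 1 * a + + 0 * c ≡ a
  select = solve-∀

det-· : ∀ A B → det (A · B) ≡ det A * det B
det-· (mat a b c d) (mat e f g h) = identity a b c d e f g h
  where
  identity : ∀ a b c d e f g h → (a * e + b * g) * (c * f + d * h) - (a * f + b * h) * (c * e + d * g)
                                 ≡ (a * d - b * c) * (e * h - f * g)
  identity = solve-∀

IsUnit : ℤ → Set
IsUnit x = (x ≡ + 1) ⊎ (x ≡ - (+ 1))

IsUnit-* : ∀ {x y} → IsUnit x → IsUnit y → IsUnit (x * y)
IsUnit-* (inj₁ refl) (inj₁ refl) = inj₁ refl
IsUnit-* (inj₁ refl) (inj₂ refl) = inj₂ refl
IsUnit-* (inj₂ refl) (inj₁ refl) = inj₂ refl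
IsUnit-* (inj₂ refl) (inj₂ refl) = inj₁ refl

InGL-φ₁ : ∀ c → InGL (φ₁ c)
InGL-φ₁ X = inj₁ refl
InGL-φ₁ N = inj₂ refl
InGL-φ₁ S = inj₁ refl
InGL-φ₁ R = inj₁ refl

InGL-φ : ∀ w → InGL (φ w)
InGL-φ []      = inj₁ refl
InGL-φ (c ∷ w) = subst IsUnit (sym (det-· (φ₁ c) (φ w))) (IsUnit-* (InGL-φ₁ c) (InGL-φ w))

does⇔ : ∀ {A : Set} (a? : Dec A) → A ⇔ (does a? ≡ true)
does⇔ (yes a)  = mk⇔ (λ _ → refl) (λ _ → a)
does⇔ (no ¬a) = mk⇔ (λ a → contradiction a ¬a) (λ ())

Regular-resp-⇔ : ∀ {L L′ : Language} → (∀ w → L w ⇔ L′ w) → Regular L → Regular L′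
Regular-resp-⇔ L⇔L′ (A , L⇔A) = A , λ w → ⇔.trans (⇔.sym (L⇔L′ w)) (L⇔A w)

Regular-from-↔ : ∀ {Q : Set} {k} → Fin k ↔ Q → (step : Q → Letter → Q) (q₀ : Q)
                 (Accept : Q → Set) → Decidable Accept → Regular (λ w → Accept (foldl step q₀ w))
Regular-from-↔ {Q} {k} Fin↔Q step q₀ Accept accept? = automaton , λ w →
  subst (λ q → Accept q ⇔ DFA.Accepts automaton w) (to-run q₀ w)
        (does⇔ (accept? (to (DFA.run automaton (from q₀) w))))
  where
  open Inverse Fin↔Q
  automaton : DFA
  automaton = record
    { k = k ; δ = λ q c → from (step (to q) c) ; start = from q₀ ; accept = λ q → does (accept? (to q)) }
  to-run : ∀ q w → to (DFA.run automaton (from q) w) ≡ foldl step q w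
  to-run q []      = strictlyInverseˡ q
  to-run q (c ∷ w) rewrite strictlyInverseˡ q = to-run (step q c) w

∣-<⇒≡0 : ∀ {n d} → n ℕ.∣ d → d ℕ.< n → d ≡ 0
∣-<⇒≡0 {d = 0}       _   _   = refl
∣-<⇒≡0 {d = ℕ.suc _} n∣d d<n = contradiction n∣d (ℕ.>⇒∤ d<n)

module Residues (n : ℕ) .{{_ : NonZero n}} where

  infix 4 _≈_

  record _≈_ (x y : ℤ) : Set where
    constructor congruent
    field divides-difference : + n Signed.∣ x - y

  ≈-sym : ∀ {x y} → x ≈ y → y ≈ x
  ≈-sym {x} {y} (congruent x≈y) = congruent (subst (+ n Signed.∣_) (negate x y) (Signed.∣m⇒∣-m x≈y))
    where
    negate : ∀ x y → - (x - y) ≡ y - x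
    negate = solve-∀

  ≈-trans : ∀ {x y z} → x ≈ y → y ≈ z → x ≈ z
  ≈-trans {x} {y} {z} (congruent x≈y) (congruent y≈z) =
    congruent (subst (+ n Signed.∣_) (telescope x y z) (Signed.∣m∣n⇒∣m+n x≈y y≈z))
    where
    telescope : ∀ x y z → (x - y) + (y - z) ≡ x - z
    telescope = solve-∀

  ≈-linear : ∀ {x x′ y y′} a b → x ≈ x′ → y ≈ y′ → x * a + y * b ≈ x′ * a + y′ * b
  ≈-linear {x} {x′} {y} {y′} a b (congruent x≈x′) (congruent y≈y′) = congruent
    (subst (+ n Signed.∣_) (collect x x′ y y′ a b) (Signed.∣m∣n⇒∣m+n (Signed.∣m⇒∣m*n a x≈x′) (Signed.∣m⇒∣m*n b y≈y′)))
    where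
    collect : ∀ x x′ y y′ a b → (x - x′) * a + (y - y′) * b ≡ (x * a + y * b) - (x′ * a + y′ * b)
    collect = solve-∀

  ∣⇔≈0 : ∀ {x} → + n ∣ x ⇔ x ≈ 0ℤ
  ∣⇔≈0 {x} = mk⇔ (λ n∣x → congruent (subst (+ n Signed.∣_) (sym (+-identityʳ x)) (∣ᵤ⇒∣ n∣x)))
                 (λ (congruent x≈0) → ∣⇒∣ᵤ (subst (+ n Signed.∣_) (+-identityʳ x) x≈0))

  residue : ℤ → Fin n
  residue x = fromℕ< (n%ℕd<d x n)

  lift : Fin n → ℤ
  lift s = + toℕ s

  ≈-lift-residue : ∀ x → x ≈ lift (residue x)
  ≈-lift-residue x = congruent (divides (x /ℕ n) (begin
    x - lift (residue x)                      ≡⟨ cong (λ r → x - + r) (toℕ-fromℕ< (n%ℕd<d x n)) ⟩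
    x - + (x %ℕ n)                            ≡⟨ cong (_- + (x %ℕ n)) (a≡a%ℕn+[a/ℕn]*n x n) ⟩
    + (x %ℕ n) + (x /ℕ n) * + n - + (x %ℕ n)  ≡⟨ cancel (+ (x %ℕ n)) ((x /ℕ n) * + n) ⟩
    (x /ℕ n) * + n                            ∎))
    where
    open ≡-Reasoning
    cancel : ∀ r m → r + m - r ≡ m
    cancel = solve-∀

  lift-injective : ∀ {s t} → lift s ≈ lift t → s ≡ t
  lift-injective {s} {t} (congruent s≈t) =
    toℕ-injective (+-injective (i-j≡0⇒i≡j _ _ (∣i∣≡0⇒i≡0 (∣-<⇒≡0 (∣⇒∣ᵤ s≈t) distance<n))))
    where
    distance<n : ∣ lift s - lift t ∣ ℕ.< n
    distance<n = subst (ℕ._< n) (cong ∣_∣ (sym ([+m]-[+n]≡m⊖n (toℕ s) (toℕ t))))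
                   (ℕ.≤-<-trans (∣m⊝n∣≤m⊔n (toℕ s) (toℕ t)) (ℕ.⊔-lub (toℕ<n s) (toℕ<n t)))

  residue-≡⇔≈ : ∀ {x y} → residue x ≡ residue y ⇔ x ≈ y
  residue-≡⇔≈ {x} {y} = mk⇔
    (λ eq → ≈-trans (≈-lift-residue x) (subst (λ s → lift s ≈ y) (sym eq) (≈-sym (≈-lift-residue y))))
    (λ x≈y → lift-injective (≈-trans (≈-sym (≈-lift-residue x)) (≈-trans x≈y (≈-lift-residue y))))

  ∣⇔residue≡0 : ∀ {x} → + n ∣ x ⇔ residue x ≡ residue 0ℤ
  ∣⇔residue≡0 {x} = ⇔.trans ∣⇔≈0 (⇔.sym (residue-≡⇔≈ {x}))

  residue² : Row → Fin n × Fin n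
  residue² (x , y) = residue x , residue y

  lift² : Fin n × Fin n → Row
  lift² (s , t) = lift s , lift t

  step : Fin n × Fin n → Letter → Fin n × Fin n
  step s c = residue² (lift² s ⋆ φ₁ c)

  residue²-⋆ : ∀ r M → residue² (lift² (residue² r) ⋆ M) ≡ residue² (r ⋆ M)
  residue²-⋆ (x , y) (mat a b c d) = cong₂ _,_ (reduce a c) (reduce b d)
    where
    reduce : ∀ a c → residue (lift (residue x) * a + lift (residue y) * c) ≡ residue (x * a + y * c)
    reduce a c = Equivalence.from residue-≡⇔≈
      (≈-linear a c (≈-sym (≈-lift-residue x)) (≈-sym (≈-lift-residue y)))

  foldl-step : ∀ r w → foldl step (residue² r) w ≡ residue² (r ⋆ φ w)
  foldl-step r []      = cong residue² (sym (⋆-I₂ r))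
  foldl-step r (c ∷ w) = begin
    foldl step (step (residue² r) c) w  ≡⟨ cong (λ s → foldl step s w) (residue²-⋆ r (φ₁ c)) ⟩
    foldl step (residue² (r ⋆ φ₁ c)) w  ≡⟨ foldl-step (r ⋆ φ₁ c) w ⟩
    residue² (r ⋆ φ₁ c ⋆ φ w)           ≡⟨ cong residue² (sym (⋆-· r (φ₁ c) (φ w))) ⟩
    residue² (r ⋆ (φ₁ c · φ w))         ∎
    where open ≡-Reasoning

  Regular-residue² : ∀ r (Accept : Fin n × Fin n → Set) → Decidable Accept →
                     Regular (λ w → Accept (residue² (r ⋆ φ w)))
  Regular-residue² r Accept accept? =
    Regular-resp-⇔ (λ w → mk⇔ (subst Accept (foldl-step r w)) (subst Accept (sym (foldl-step r w))))
                   (Regular-from-↔ *↔× step (residue² r) Accept accept?)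

  Regular-divisible-entry : ∀ (entry : Mat2 → ℤ) r (pick : Fin n × Fin n → Fin n) →
                            (∀ M → pick (residue² (r ⋆ M)) ≡ residue (entry M)) →
                            Regular (λ w → + n ∣ entry (φ w))
  Regular-divisible-entry entry r pick pick-residue² =
    Regular-resp-⇔ (λ w → ⇔.sym (subst (λ s → + n ∣ entry (φ w) ⇔ s ≡ residue 0ℤ)
                                        (sym (pick-residue² (φ w))) (∣⇔residue≡0 {entry (φ w)})))
                   (Regular-residue² r (λ s → pick s ≡ residue 0ℤ) (λ s → pick s Fin.≟ residue 0ℤ))

  Regular-H : Regular (Lang (H n))
  Regular-H = Regular-resp-⇔ (λ w → mk⇔ (InGL-φ w ,_) proj₂)
    (Regular-divisible-entry a21 (+ 0 , + 1) proj₁ (cong (proj₁ ∘ residue²) ∘ e₂⋆≡bottom-row))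

  Regular-F : Regular (Lang (F n))
  Regular-F = Regular-resp-⇔ (λ w → mk⇔ (InGL-φ w ,_) proj₂)
    (Regular-divisible-entry a12 (+ 1 , + 0) proj₂ (cong (proj₂ ∘ residue²) ∘ e₁⋆≡top-row))

lemma1 : ∀ (n : ℕ) → n ≥ 1 → Regular (Lang (H n)) × Regular (Lang (F n))
lemma1 n n≥1 = Regular-H , Regular-F
  where
  instance
    _ : NonZero n
    _ = >-nonZero n≥1
  open Residues n
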